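{- Let $T\subseteq X_0$ be a generalised nice set with $\langle P_{\{1,2,1\}}\rangle\subseteq T$, and let $k\in I$, $k\neq 1$. If $T$ contains $\{0,k\}$ or $\{1,k\}$, then $\{\{0,k\},\{0,k*1\},\{1,k\},\{1,k*1\}\}\subseteq T$.
   Context: Let $I=\{1,\dots,7\}$ and $I_0=I\cup\{0\}$. The Fano plane on $I$ has the seven lines $\{1,2,5\},\{5,6,7\},\{1,4,7\},\{1,3,6\},\{2,4,6\},\{2,3,7\},\{3,4,5\}$. For distinct $i,j\in I$, $i*j$ is the third point of the unique line containing $i$ and $j$. The operation is extended to $I_0$ by $0*i=i*0=i$ and $i*i=0$ for all $i\in I_0$. Let $X_0$ be the set of unordered pairs $\{i,j\}$ with $i,j\in I_0$, where $i=j$ is allowed. For $i,j,k\in I_0$ let $P_{\{i,j,k\}}=\{\{i,j\},\{j,k\},\{k,i\},\{i,j*k\},\{j,k*i\},\{k,i*j\}\}\subseteq X_0$. A subset $T\subseteq X_0$ is a generalised nice set if for all $i,j,k\in I_0$, $\{i,j\}\in T$ and $\{i*j,k\}\in T$ imply $P_{\{i,j,k\}}\subseteq T$. For $S\subseteq X_0$, $\langle S\rangle$ denotes the smallest generalised nice set containing $S$. -}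

module Defs where

open import Data.Bool using (Bool; true; false; if_then_else_; _∧_; _∨_; not; T)
open import Data.Fin using (Fin; zero; suc; toℕ; #_; _≟_)
open import Data.Nat using (ℕ; _≤ᵇ_)
import Data.Nat
open import Data.Nat.Properties using (≤ᵇ⇒≤; ≤⇒≤ᵇ; ≰⇒>; <⇒≤)
open import Data.Product using (_×_; _,_)
open import Data.List using (List; []; _∷_)
open import Data.List.Relation.Unary.All using (All)
open import Data.Unit using (tt)
open import Data.Empty using (⊥)
open import Data.List.Membership.Propositional using (_∈_)
open import Data.Maybe using (Maybe; just; nothing)
open import Relation.Nullary using (does)
open import Relation.Binary.PropositionalEquality using (_≡_; refl)
open import Level using (suc; zero) renaming (_⊔_ to _l⊔_)

-- I₀ = {0,1,...,7}; the element 0 is (# 0), the points of the Fano plane are # 1 .. # 7.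
I₀ : Set
I₀ = Fin 8

_==_ : I₀ → I₀ → Bool
i == j = does (i ≟ j)

fanoLines : List (I₀ × I₀ × I₀)
fanoLines =
  (# 1 , # 2 , # 5) ∷ (# 5 , # 6 , # 7) ∷ (# 1 , # 4 , # 7) ∷ (# 1 , # 3 , # 6) ∷
  (# 2 , # 4 , # 6) ∷ (# 2 , # 3 , # 7) ∷ (# 3 , # 4 , # 5) ∷ []

thirdOn : I₀ → I₀ → I₀ × I₀ × I₀ → Maybe I₀
thirdOn i j (a , b , c) =
  if onL i ∧ onL j ∧ not (i == j)
  then just (if not (a == i) ∧ not (a == j) then a
             else if not (b == i) ∧ not (b == j) then b else c)
  else nothing
  where
  onL : I₀ → Bool
  onL x = (x == a) ∨ (x == b) ∨ (x == c)

findThird : I₀ → I₀ → List (I₀ × I₀ × I₀) → I₀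
findThird i j [] = # 0   -- never reached for distinct i, j ∈ I
findThird i j (l ∷ ls) with thirdOn i j l
... | just x  = x
... | nothing = findThird i j ls

infixl 7 _*_
_*_ : I₀ → I₀ → I₀
i * j =
  if i == (# 0) then j
  else if j == (# 0) then i
  else if i == j then # 0
  else findThird i j fanoLines

-- X₀: unordered pairs {i,j} of elements of I₀ (i = j allowed),
-- represented canonically as (lo , hi) with lo ≤ hi.
record X₀ : Set where
  constructor mkX
  field
    lo : I₀
    hi : I₀
    ordered : T (toℕ lo ≤ᵇ toℕ hi)

⁅_,_⁆ : I₀ → I₀ → X₀
⁅ i , j ⁆ with toℕ i ≤ᵇ toℕ j in eq
... | true  = mkX i j (true-T eq)
  where
  true-T : ∀ {b} → b ≡ true → T b
  true-T refl = tt
... | false = mkX j i (≤⇒≤ᵇ (<⇒≤ (≰⇒> λ i≤j → false-not-T eq (≤ᵇ-witness i≤j))))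
  where
  false-not-T : ∀ {b} → b ≡ false → T b → ⊥
  false-not-T refl ()
  ≤ᵇ-witness : toℕ i Data.Nat.≤ toℕ j → T (toℕ i ≤ᵇ toℕ j)
  ≤ᵇ-witness = ≤⇒≤ᵇ

Subset : Set₁
Subset = X₀ → Set

Plist : I₀ → I₀ → I₀ → List X₀
Plist i j k =
  ⁅ i , j ⁆ ∷ ⁅ j , k ⁆ ∷ ⁅ k , i ⁆ ∷
  ⁅ i , j * k ⁆ ∷ ⁅ j , k * i ⁆ ∷ ⁅ k , i * j ⁆ ∷ []

_⊆P_ : List X₀ → Subset → Set
xs ⊆P T' = All T' xs

_⊆_ : ∀ {ℓ ℓ'} → (X₀ → Set ℓ) → (X₀ → Set ℓ') → Set (ℓ l⊔ ℓ')
A ⊆ B = ∀ x → A x → B x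

GenNice : Subset → Set
GenNice T' = ∀ i j k → T' ⁅ i , j ⁆ → T' ⁅ i * j , k ⁆ → Plist i j k ⊆P T'

-- ⟨S⟩: the smallest generalised nice set containing S (intersection of all
-- generalised nice sets containing S).
⟨_⟩ : Subset → X₀ → Set₁
⟨ S ⟩ x = (T' : Subset) → GenNice T' → S ⊆ T' → T' x

Pset : I₀ → I₀ → I₀ → Subset
Pset i j k x = x ∈ Plist i j k

{-# OPTIONS --safe #-}
-- For any a, the rule applied to {a,a} (note a * a = 0) and {0,k} yields {a,k} and {a,k*a}, and
-- applied to {0,k} and {k,a} (note 0 * k = k) it yields {0,k*a}; applied to {0,a} and {a,k} it
-- recovers {0,k}. As ⟨P_{1,2,1}⟩ contains {1,1} and, via {0,2} and {2,1}, also {0,1}, the claim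
-- follows with a = 1.
module Submission where

open import Defs
open import Data.Bool.Properties using (T-irrelevant)
open import Data.Fin using (#_; _≟_)
open import Data.Fin.Properties using (all?)
open import Data.List.Relation.Unary.All using (_∷_)
open import Data.List.Relation.Unary.Any using (here; there)
open import Data.Product using (_×_; _,_; uncurry)
open import Data.Sum using (_⊎_; inj₁; inj₂)
open import Relation.Binary.Definitions using (DecidableEquality)
open import Relation.Binary.PropositionalEquality using (_≡_; _≢_; refl; sym; cong; subst)
open import Relation.Nullary.Decidable using (from-yes; map′; _×-dec_)

open X₀ using (lo; hi)

X₀-≡ : ∀ {x y : X₀} → lo x ≡ lo y → hi x ≡ hi y → x ≡ y
X₀-≡ {mkX l h p} {mkX .l .h q} refl refl = cong (mkX l h) (T-irrelevant p q)

_≟ₓ_ : DecidableEquality X₀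
x ≟ₓ y = map′ (uncurry X₀-≡) (λ { refl → refl , refl }) ((lo x ≟ lo y) ×-dec (hi x ≟ hi y))

⁅⁆-comm : ∀ i j → ⁅ i , j ⁆ ≡ ⁅ j , i ⁆
⁅⁆-comm = from-yes (all? λ i → all? λ j → ⁅ i , j ⁆ ≟ₓ ⁅ j , i ⁆)

*-selfInverse : ∀ i → i * i ≡ # 0
*-selfInverse = from-yes (all? λ i → i * i ≟ # 0)

⟨⟩-extensive : (S : Subset) → S ⊆ ⟨ S ⟩
⟨⟩-extensive S x x∈S _ _ S⊆T = S⊆T x x∈S

module _ {T : Subset} {i j k : I₀} where

  P-jk : Plist i j k ⊆P T → T ⁅ j , k ⁆
  P-jk (_ ∷ x ∷ _) = x

  P-ki : Plist i j k ⊆P T → T ⁅ k , i ⁆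
  P-ki (_ ∷ _ ∷ x ∷ _) = x

  P-i[jk] : Plist i j k ⊆P T → T ⁅ i , j * k ⁆
  P-i[jk] (_ ∷ _ ∷ _ ∷ x ∷ _) = x

  P-j[ki] : Plist i j k ⊆P T → T ⁅ j , k * i ⁆
  P-j[ki] (_ ∷ _ ∷ _ ∷ _ ∷ x ∷ _) = x

Square : Subset → I₀ → I₀ → Set
Square T a k = T ⁅ # 0 , k ⁆ × T ⁅ # 0 , k * a ⁆ × T ⁅ a , k ⁆ × T ⁅ a , k * a ⁆

module _ {T : Subset} (nice : GenNice T) {a k : I₀} where

  0k⇒Square : T ⁅ a , a ⁆ → T ⁅ # 0 , k ⁆ → Square T a k
  0k⇒Square Taa T0k = T0k , T0[ka] , P-jk Paak , Ta[ka]
    where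
    Paak : Plist a a k ⊆P T
    Paak = nice a a k Taa (subst (λ z → T ⁅ z , k ⁆) (sym (*-selfInverse a)) T0k)

    Ta[ka] : T ⁅ a , k * a ⁆
    Ta[ka] = P-j[ki] Paak

    T0[ka] : T ⁅ # 0 , k * a ⁆
    T0[ka] = P-i[jk] (nice (# 0) k a T0k (subst T (⁅⁆-comm a k) (P-jk Paak)))

  ak⇒0k : T ⁅ # 0 , a ⁆ → T ⁅ a , k ⁆ → T ⁅ # 0 , k ⁆
  ak⇒0k T0a Tak = subst T (⁅⁆-comm k (# 0)) (P-ki (nice (# 0) a k T0a Tak))

  0k⊎ak⇒Square : T ⁅ a , a ⁆ → T ⁅ # 0 , a ⁆ → T ⁅ # 0 , k ⁆ ⊎ T ⁅ a , k ⁆ → Square T a k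
  0k⊎ak⇒Square Taa _   (inj₁ T0k) = 0k⇒Square Taa T0k
  0k⊎ak⇒Square Taa T0a (inj₂ Tak) = 0k⇒Square Taa (ak⇒0k T0a Tak)

lemma5p3 : (T : Subset) → GenNice T → ⟨ Pset (# 1) (# 2) (# 1) ⟩ ⊆ T →
    (k : I₀) → k ≢ # 0 → k ≢ # 1 →
    T ⁅ # 0 , k ⁆ ⊎ T ⁅ # 1 , k ⁆ →
    T ⁅ # 0 , k ⁆ × T ⁅ # 0 , k * # 1 ⁆ × T ⁅ # 1 , k ⁆ × T ⁅ # 1 , k * # 1 ⁆
lemma5p3 T nice ⟨P⟩⊆T k _ _ = 0k⊎ak⇒Square nice T11 T01
  where
  P⊆T : Pset (# 1) (# 2) (# 1) ⊆ T
  P⊆T x x∈P = ⟨P⟩⊆T x (⟨⟩-extensive _ x x∈P)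

  T11 : T ⁅ # 1 , # 1 ⁆
  T11 = P⊆T _ (there (there (here refl)))

  T21 : T ⁅ # 2 , # 1 ⁆
  T21 = P⊆T _ (there (here refl))

  T02 : T ⁅ # 0 , # 2 ⁆
  T02 = P⊆T _ (there (there (there (there (here refl)))))

  T01 : T ⁅ # 0 , # 1 ⁆
  T01 = ak⇒0k nice {# 2} {# 1} T02 T21
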